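{- Let $q$ be an odd prime power and let $\chi$ be the modified algebraic coloring of the complete graph on $\mathbb{F}_q^2$ defined in the context. There do not exist distinct $a,b,c,d,e\in\mathbb{F}_q^2$ with $\chi(ab)=\chi(cd)=\chi(de)$ and $\chi(bc)=\chi(ad)=\chi(be)$.
   Context: Vertices are vectors $x=(x_1,x_2)\in\mathbb{F}_q^2$. For distinct $x,y$ let $\chi_1(xy)=(x_1y_1-x_2-y_2,\ \delta(x_1,y_1))$ with $\delta(x_1,y_1)=0$ if $x_1=y_1$ and $1$ otherwise (field operations in $\mathbb{F}_q$). For $\alpha\in\mathbb{F}_q$, the graph $G_\alpha$ on $\mathbb{F}_q\setminus\{\alpha\}$ with edges $\{x,y\}$, $x+y=2\alpha$, is a perfect matching; fix a partition $\mathbb{F}_q\setminus\{\alpha\}=S_\alpha\cup T_\alpha$ with each matching edge having one endpoint in each part, and for $\beta\ne\alpha$ let $f_\alpha(\beta)=S$ if $\beta\in S_\alpha$ and $T$ if $\beta\in T_\alpha$. Fix a linear order $<$ on $\mathbb{F}_q^2$. For $x<y$ with $x_1\ne y_1$ let $\chi_2(xy)=(f_{x_1}(y_1),f_{y_1}(x_1))$; when $x_1=y_1$, $\chi_2(xy)$ is some fixed value. Then $\chi(xy)=(\chi_1(xy),\chi_2(xy))$. -}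

module Defs where

open import Level using (0ℓ)
open import Algebra.Core using (Op₁; Op₂)
open import Algebra.Structures using (IsCommutativeRing)
open import Data.Nat as ℕ using (ℕ; _^_)
open import Data.Nat.Divisibility using (_∣_)
open import Data.Nat.Primality using (Prime)
open import Data.Fin as Fin using (Fin)
import Data.Fin.Properties as FinP
open import Data.Bool using (Bool; true; false)
open import Data.Product using (_×_; _,_; ∃; ∃-syntax; proj₁; proj₂)
open import Function.Bundles using (_↔_; Inverse)
open import Relation.Nullary using (¬_; Dec; yes; no)
open import Relation.Binary.Core using (Rel)
open import Relation.Binary.Definitions using (tri<; tri≈; tri>)
open import Relation.Binary.Structures using (IsStrictTotalOrder)
open import Relation.Binary.PropositionalEquality

Odd : ℕ → Set
Odd q = ¬ (2 ∣ q)

PrimePower : ℕ → Set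
PrimePower q = ∃[ p ] ∃[ k ] (Prime p × q ≡ p ^ k)

record FiniteField (q : ℕ) : Set₁ where
  infixl 6 _+_ _-_
  infix 8 -_
  infixl 7 _*_
  field
    Carrier           : Set
    _+_ _*_           : Op₂ Carrier
    -_                : Op₁ Carrier
    0# 1#             : Carrier
    isCommutativeRing : IsCommutativeRing _≡_ _+_ _*_ -_ 0# 1#
    0≢1               : ¬ (0# ≡ 1#)
    inverse           : ∀ x → ¬ (x ≡ 0#) → ∃[ y ] (x * y ≡ 1#)
    enum              : Carrier ↔ Fin q

  _-_ : Op₂ Carrier
  x - y = x + (- y)

  _≟_ : (x y : Carrier) → Dec (x ≡ y)
  x ≟ y with Fin._≟_ (Inverse.to enum x) (Inverse.to enum y)
  ... | yes e = yes (trans (sym (Inverse.inverseʳ enum refl))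
                    (trans (cong (Inverse.from enum) e) (Inverse.inverseʳ enum refl)))
  ... | no ne = no (λ e → ne (cong (Inverse.to enum) e))

data Side : Set where
  S T : Side

module Coloring {q : ℕ} (F : FiniteField q) where
  open FiniteField F

  Point : Set
  Point = Carrier × Carrier

  -- δ(x₁,y₁) = 0 (false) if x₁ = y₁, and 1 (true) otherwise
  δ : Carrier → Carrier → Bool
  δ a b with a ≟ b
  ... | yes _ = false
  ... | no  _ = true

  χ₁ : Point → Point → Carrier × Bool
  χ₁ (x₁ , x₂) (y₁ , y₂) = (x₁ * y₁ - x₂ - y₂ , δ x₁ y₁)

  -- For every α, f α : F \ {α} → {S,T} encodes a partition S_α ∪ T_α of
  -- F \ {α} such that every edge {β, 2α − β} of the perfect matching G_α
  -- has one endpoint in each part.  (The value f α α is irrelevant.)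
  record MatchingPartition : Set where
    field
      f     : Carrier → Carrier → Side
      split : ∀ α β → ¬ (β ≡ α) → ¬ (f α β ≡ f α ((α + α) - β))

  Colour : Set
  Colour = (Carrier × Bool) × (Side × Side)

  module _ (P : MatchingPartition) (fixed : Side × Side) where
    open MatchingPartition P

    -- χ₂ on an ordered pair (x,y) with x < y
    χ₂ : Point → Point → Side × Side
    χ₂ (x₁ , x₂) (y₁ , y₂) with x₁ ≟ y₁
    ... | yes _ = fixed
    ... | no  _ = (f x₁ y₁ , f y₁ x₁)

    module _ {_<_ : Rel Point 0ℓ} (sto : IsStrictTotalOrder _≡_ _<_) where
      open IsStrictTotalOrder sto using (compare)

      colOrd : Point → Point → Colour
      colOrd x y = (χ₁ x y , χ₂ x y)

      χ : Point → Point → Colour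
      χ x y with compare x y
      ... | tri< _ _ _ = colOrd x y
      ... | tri≈ _ _ _ = colOrd x y
      ... | tri> _ _ _ = colOrd y x

Distinct5 : {A : Set} → A → A → A → A → A → Set
Distinct5 a b c d e =
  ¬ a ≡ b × ¬ a ≡ c × ¬ a ≡ d × ¬ a ≡ e ×
  ¬ b ≡ c × ¬ b ≡ d × ¬ b ≡ e ×
  ¬ c ≡ d × ¬ c ≡ e × ¬ d ≡ e

-- Write g(x, y) = x₁y₁ − x₂ − y₂ for the first entry of χ₁(xy); only this entry is
-- needed.  Equal colours give g(c,d) = g(e,d) and g(c,b) = g(e,b).  For fixed x, z
-- the points y with g(x,y) = g(z,y) satisfy (x₁ − z₁)y₁ = x₂ − z₂, so if c₁ = e₁
-- then c = e, and otherwise b and d lie on one vertical line: b₁ = d₁.  In the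
-- latter case g(a,b) = g(c,d) and g(c,b) = g(a,d) add up to 2b₂ = 2d₂, hence b = d
-- since the characteristic is not 2.
module Submission where

open import Defs
open import Level using (0ℓ)
open import Data.Nat using (ℕ)
open import Data.Product using (_×_; _,_; proj₁; proj₂; ∃-syntax)
open import Relation.Nullary using (¬_; yes; no)
open import Relation.Binary.Core using (Rel)
open import Function using (case_of_)
open import Relation.Binary.Definitions using (tri<; tri≈; tri>)
open import Relation.Binary.Structures using (IsStrictTotalOrder)
open import Relation.Binary.PropositionalEquality using (_≡_)
open import Algebra.Bundles using (CommutativeRing)

module PairingForm {c ℓ} (R : CommutativeRing c ℓ) where
  open CommutativeRing R
  open import Algebra.Properties.Ring ring using (//-rightDividesˡ; +-cancelˡ; +-cancelʳ)
  open import Algebra.Properties.CommutativeSemigroup +-commutativeSemigroup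
    using (interchange; xy∙z≈xz∙y)
  open import Algebra.Solver.Ring.NaturalCoefficients.Default commutativeSemiring
  open import Relation.Binary.Reasoning.Setoid setoid

  pairing : Carrier × Carrier → Carrier × Carrier → Carrier
  pairing (x₁ , x₂) (y₁ , y₂) = x₁ * y₁ - x₂ - y₂

  pairing-comm : ∀ x y → pairing x y ≈ pairing y x
  pairing-comm (x₁ , x₂) (y₁ , y₂) =
    solve 4 (λ u v s t → u :* v :+ s :+ t := v :* u :+ t :+ s) refl x₁ y₁ (- x₂) (- y₂)

  pairing-+-snd : ∀ x y → pairing x y + (proj₂ x + proj₂ y) ≈ proj₁ x * proj₁ y
  pairing-+-snd (x₁ , x₂) (y₁ , y₂) = begin
    x₁ * y₁ - x₂ - y₂ + (x₂ + y₂)   ≈⟨ +-congˡ (+-comm x₂ y₂) ⟩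
    x₁ * y₁ - x₂ - y₂ + (y₂ + x₂)   ≈⟨ +-assoc _ y₂ x₂ ⟨
    x₁ * y₁ - x₂ - y₂ + y₂ + x₂     ≈⟨ +-congʳ (//-rightDividesˡ y₂ (x₁ * y₁ - x₂)) ⟩
    x₁ * y₁ - x₂ + x₂               ≈⟨ //-rightDividesˡ x₂ (x₁ * y₁) ⟩
    x₁ * y₁                         ∎

  pairing-≈⇒ : ∀ {x y z w} → pairing x y ≈ pairing z w →
               proj₁ x * proj₁ y + (proj₂ z + proj₂ w) ≈ proj₁ z * proj₁ w + (proj₂ x + proj₂ y)
  pairing-≈⇒ {x} {y} {z} {w} xy≈zw = begin
    proj₁ x * proj₁ y + (z₂ + w₂)        ≈⟨ +-congʳ (pairing-+-snd x y) ⟨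
    pairing x y + (x₂ + y₂) + (z₂ + w₂)  ≈⟨ +-congʳ (+-congʳ xy≈zw) ⟩
    pairing z w + (x₂ + y₂) + (z₂ + w₂)  ≈⟨ xy∙z≈xz∙y _ _ _ ⟩
    pairing z w + (z₂ + w₂) + (x₂ + y₂)  ≈⟨ +-congʳ (pairing-+-snd z w) ⟩
    proj₁ z * proj₁ w + (x₂ + y₂)        ∎
    where
    x₂ = proj₂ x; y₂ = proj₂ y; z₂ = proj₂ z; w₂ = proj₂ w

  pairing-≈ʳ⇒ : ∀ {x z} y → pairing x y ≈ pairing z y →
                proj₁ x * proj₁ y + proj₂ z ≈ proj₁ z * proj₁ y + proj₂ x
  pairing-≈ʳ⇒ {x} {z} y xy≈zy = +-cancelʳ (proj₂ y) _ _ (begin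
    proj₁ x * proj₁ y + proj₂ z + proj₂ y    ≈⟨ +-assoc _ _ _ ⟩
    proj₁ x * proj₁ y + (proj₂ z + proj₂ y)  ≈⟨ pairing-≈⇒ xy≈zy ⟩
    proj₁ z * proj₁ y + (proj₂ x + proj₂ y)  ≈⟨ +-assoc _ _ _ ⟨
    proj₁ z * proj₁ y + proj₂ x + proj₂ y    ∎)

  pairing-≈ʳ-fst≈⇒snd≈ : ∀ {x z} y → proj₁ x ≈ proj₁ z → pairing x y ≈ pairing z y →
                         proj₂ x ≈ proj₂ z
  pairing-≈ʳ-fst≈⇒snd≈ {x} {z} y x₁≈z₁ xy≈zy = sym (+-cancelˡ (proj₁ z * proj₁ y) _ _ (begin
    proj₁ z * proj₁ y + proj₂ z  ≈⟨ +-congʳ (*-congʳ x₁≈z₁) ⟨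
    proj₁ x * proj₁ y + proj₂ z  ≈⟨ pairing-≈ʳ⇒ y xy≈zy ⟩
    proj₁ z * proj₁ y + proj₂ x  ∎))

  pairing-≈ʳ-twice⇒ : ∀ {x z} y w → pairing x y ≈ pairing z y → pairing x w ≈ pairing z w →
                      proj₁ x * proj₁ y + proj₁ z * proj₁ w
                        ≈ proj₁ z * proj₁ y + proj₁ x * proj₁ w
  pairing-≈ʳ-twice⇒ {x} {z} y w xy≈zy xw≈zw = +-cancelʳ (proj₂ z + proj₂ x) _ _ (begin
    x₁ * y₁ + z₁ * w₁ + (z₂ + x₂)  ≈⟨ interchange _ _ _ _ ⟩
    x₁ * y₁ + z₂ + (z₁ * w₁ + x₂)  ≈⟨ +-cong (pairing-≈ʳ⇒ y xy≈zy)
                                             (sym (pairing-≈ʳ⇒ w xw≈zw)) ⟩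
    z₁ * y₁ + x₂ + (x₁ * w₁ + z₂)  ≈⟨ interchange _ _ _ _ ⟩
    z₁ * y₁ + x₁ * w₁ + (x₂ + z₂)  ≈⟨ +-congˡ (+-comm x₂ z₂) ⟩
    z₁ * y₁ + x₁ * w₁ + (z₂ + x₂)  ∎)
    where
    x₁ = proj₁ x; x₂ = proj₂ x; z₁ = proj₁ z; z₂ = proj₂ z; y₁ = proj₁ y; w₁ = proj₁ w

  pairing-crossed⇒ : ∀ {a c} u {s t} → pairing a (u , s) ≈ pairing c (u , t) →
                     pairing c (u , s) ≈ pairing a (u , t) → t + t ≈ s + s
  pairing-crossed⇒ {a₁ , a₂} {c₁ , c₂} u {s} {t} as≈ct cs≈at = +-cancelʳ K _ _ (begin
    (t + t) + K                                ≈⟨ regroup t ⟩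
    (a₁ * u + (c₂ + t)) + (c₁ * u + (a₂ + t))  ≈⟨ +-cong (pairing-≈⇒ as≈ct) (pairing-≈⇒ cs≈at) ⟩
    (c₁ * u + (a₂ + s)) + (a₁ * u + (c₂ + s))  ≈⟨ +-comm _ _ ⟩
    (a₁ * u + (c₂ + s)) + (c₁ * u + (a₂ + s))  ≈⟨ regroup s ⟨
    (s + s) + K                                ∎)
    where
    K = a₁ * u + c₁ * u + (a₂ + c₂)
    regroup : ∀ v → (v + v) + K ≈ (a₁ * u + (c₂ + v)) + (c₁ * u + (a₂ + v))
    regroup = solve 5 (λ p r a₂ c₂ v → (v :+ v) :+ (p :+ r :+ (a₂ :+ c₂))
                                    := (p :+ (c₂ :+ v)) :+ (r :+ (a₂ :+ v)))
                      refl (a₁ * u) (c₁ * u) a₂ c₂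

module FiniteFieldProperties {q} (F : FiniteField q) where
  open FiniteField F
  open import Relation.Binary.PropositionalEquality
    using (refl; sym; trans; cong; cong₂; module ≡-Reasoning)
  open ≡-Reasoning

  commutativeRing : CommutativeRing 0ℓ 0ℓ
  commutativeRing = record { isCommutativeRing = isCommutativeRing }

  open CommutativeRing commutativeRing
    using (commutativeSemiring; ring; *-comm; *-assoc; *-identityˡ; +-identityˡ; distribʳ)
  open import Algebra.Properties.Ring ring using (//-rightDividesˡ; +-cancelʳ; +-inverseʳ-unique)
  open import Algebra.Solver.Ring.NaturalCoefficients.Default commutativeSemiring
  open PairingForm commutativeRing public

  *-cancelˡ-≢0 : ∀ {k} x y → ¬ k ≡ 0# → k * x ≡ k * y → x ≡ y
  *-cancelˡ-≢0 {k} x y k≢0 kx≡ky with inverse k k≢0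
  ... | i , ki≡1 = begin
    x            ≡⟨ scale x ⟨
    i * (k * x)  ≡⟨ cong (i *_) kx≡ky ⟩
    i * (k * y)  ≡⟨ scale y ⟩
    y            ∎
    where
    scale : ∀ z → i * (k * z) ≡ z
    scale z = begin
      i * (k * z)  ≡⟨ *-assoc i k z ⟨
      i * k * z    ≡⟨ cong (_* z) (trans (*-comm i k) ki≡1) ⟩
      1# * z       ≡⟨ *-identityˡ z ⟩
      z            ∎

  -- a u + b v = b u + a v says (a − b)(u − v) = 0.
  cross-cancel : ∀ {a b u v} → ¬ a ≡ b → a * u + b * v ≡ b * u + a * v → u ≡ v
  cross-cancel {a} {b} {u} {v} a≢b cross =
    *-cancelˡ-≢0 u v k≢0 (+-cancelʳ (b * u + b * v) _ _ (begin
    k * u + (b * u + b * v)  ≡⟨ solve 4 (λ k b u v → k :* u :+ (b :* u :+ b :* v)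
                                                  := (k :+ b) :* u :+ b :* v) refl k b u v ⟩
    (k + b) * u + b * v      ≡⟨ cong (λ t → t * u + b * v) a≡k+b ⟨
    a * u + b * v            ≡⟨ cross ⟩
    b * u + a * v            ≡⟨ cong (λ t → b * u + t * v) a≡k+b ⟩
    b * u + (k + b) * v      ≡⟨ solve 4 (λ k b u v → b :* u :+ (k :+ b) :* v
                                                  := k :* v :+ (b :* u :+ b :* v)) refl k b u v ⟩
    k * v + (b * u + b * v)  ∎))
    where
    k = a - b
    a≡k+b : a ≡ k + b
    a≡k+b = sym (//-rightDividesˡ b a)
    k≢0 : ¬ k ≡ 0#
    k≢0 k≡0 = a≢b (trans a≡k+b (trans (cong (_+ b) k≡0) (+-identityˡ b)))

  double-injective : ¬ 1# ≡ - 1# → ∀ {x y} → x + x ≡ y + y → x ≡ y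
  double-injective 1≢-1 {x} {y} x+x≡y+y = *-cancelˡ-≢0 x y 2≢0 (begin
    (1# + 1#) * x  ≡⟨ double x ⟩
    x + x          ≡⟨ x+x≡y+y ⟩
    y + y          ≡⟨ double y ⟨
    (1# + 1#) * y  ∎)
    where
    2≢0 : ¬ 1# + 1# ≡ 0#
    2≢0 2≡0 = 1≢-1 (+-inverseʳ-unique 1# 1# 2≡0)
    double : ∀ z → (1# + 1#) * z ≡ z + z
    double z = trans (distribʳ z 1# 1#) (cong₂ _+_ (*-identityˡ z) (*-identityˡ z))

  -- G₀ matches 1 with −1, so they lie in different parts and are distinct.  This is
  -- where odd characteristic comes from.
  matching-1≢-1 : Coloring.MatchingPartition F → ¬ 1# ≡ - 1#
  matching-1≢-1 P 1≡-1 = split 0# 1# (λ 1≡0 → 0≢1 (sym 1≡0)) (cong (f 0#) 1≡0+0-1)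
    where
    open Coloring.MatchingPartition P
    1≡0+0-1 : 1# ≡ (0# + 0#) - 1#
    1≡0+0-1 = begin
      1#            ≡⟨ 1≡-1 ⟩
      - 1#          ≡⟨ +-identityˡ (- 1#) ⟨
      0# - 1#       ≡⟨ cong (_- 1#) (+-identityˡ 0#) ⟨
      (0# + 0#) - 1# ∎

  pairing-≡ʳ-fst≡⇒≡ : ∀ {x z} y → proj₁ x ≡ proj₁ z → pairing x y ≡ pairing z y → x ≡ z
  pairing-≡ʳ-fst≡⇒≡ y x₁≡z₁ xy≡zy = cong₂ _,_ x₁≡z₁ (pairing-≈ʳ-fst≈⇒snd≈ y x₁≡z₁ xy≡zy)

  pairing-≡ʳ-twice⇒fst≡ : ∀ {x z y w} → ¬ proj₁ x ≡ proj₁ z →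
                          pairing x y ≡ pairing z y → pairing x w ≡ pairing z w → proj₁ y ≡ proj₁ w
  pairing-≡ʳ-twice⇒fst≡ {y = y} {w} x₁≢z₁ xy≡zy xw≡zw =
    cross-cancel x₁≢z₁ (pairing-≈ʳ-twice⇒ y w xy≡zy xw≡zw)

  pairing-crossed⇒≡ : ¬ 1# ≡ - 1# → ∀ {a c x y} → proj₁ x ≡ proj₁ y →
                      pairing a x ≡ pairing c y → pairing c x ≡ pairing a y → x ≡ y
  pairing-crossed⇒≡ 1≢-1 {x = u , _} refl ax≡cy cx≡ay =
    cong (u ,_) (sym (double-injective 1≢-1 (pairing-crossed⇒ u ax≡cy cx≡ay)))

module _ {q} {F : FiniteField q} (P : Coloring.MatchingPartition F) (fixed : Side × Side)
         {_<_ : Rel (Coloring.Point F) 0ℓ} (sto : IsStrictTotalOrder _≡_ _<_) where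
  open Coloring F using (χ)
  open FiniteFieldProperties F using (pairing; pairing-comm)
  open import Relation.Binary.PropositionalEquality using (refl; sym; trans; cong)

  χ-pairing : ∀ x y → proj₁ (proj₁ (χ P fixed sto x y)) ≡ pairing x y
  χ-pairing x y with IsStrictTotalOrder.compare sto x y
  ... | tri< _ _ _ = refl
  ... | tri≈ _ _ _ = refl
  ... | tri> _ _ _ = pairing-comm y x

  χ≡⇒pairing≡ : ∀ {x y z w} → χ P fixed sto x y ≡ χ P fixed sto z w → pairing x y ≡ pairing z w
  χ≡⇒pairing≡ {x} {y} {z} {w} xy~zw =
    trans (sym (χ-pairing x y)) (trans (cong (λ col → proj₁ (proj₁ col)) xy~zw) (χ-pairing z w))

lemma18 : {q : ℕ} → Odd q → PrimePower q → (F : FiniteField q) →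
          (P : Coloring.MatchingPartition F) → (fixed : Side × Side) →
          {_<_ : Rel (Coloring.Point F) 0ℓ} →
          (sto : IsStrictTotalOrder _≡_ _<_) →
          ¬ (∃[ a ] ∃[ b ] ∃[ c ] ∃[ d ] ∃[ e ]
               (Distinct5 a b c d e ×
                Coloring.χ F P fixed sto a b ≡ Coloring.χ F P fixed sto c d ×
                Coloring.χ F P fixed sto c d ≡ Coloring.χ F P fixed sto d e ×
                Coloring.χ F P fixed sto b c ≡ Coloring.χ F P fixed sto a d ×
                Coloring.χ F P fixed sto a d ≡ Coloring.χ F P fixed sto b e))
lemma18 _ _ F P fixed sto
  (a , b , c , d , e , (_ , _ , _ , _ , _ , b≢d , _ , _ , c≢e , _) , ab~cd , cd~de , bc~ad , ad~be) =
  case proj₁ c ≟ proj₁ e of λ where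
    (yes c₁≡e₁) → c≢e (pairing-≡ʳ-fst≡⇒≡ d c₁≡e₁ cd≡ed)
    (no c₁≢e₁)  → b≢d (pairing-crossed⇒≡ (matching-1≢-1 P)
                         (pairing-≡ʳ-twice⇒fst≡ c₁≢e₁ cb≡eb cd≡ed) ab≡cd cb≡ad)
  where
  open FiniteField F using (_≟_)
  open FiniteFieldProperties F
  open import Relation.Binary.PropositionalEquality using (trans)
  pairing≡ : ∀ {x y z w} → Coloring.χ F P fixed sto x y ≡ Coloring.χ F P fixed sto z w →
             pairing x y ≡ pairing z w
  pairing≡ = χ≡⇒pairing≡ P fixed sto
  ab≡cd : pairing a b ≡ pairing c d
  ab≡cd = pairing≡ ab~cd
  cb≡ad : pairing c b ≡ pairing a d
  cb≡ad = trans (pairing-comm c b) (pairing≡ bc~ad)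
  cd≡ed : pairing c d ≡ pairing e d
  cd≡ed = trans (pairing≡ cd~de) (pairing-comm d e)
  cb≡eb : pairing c b ≡ pairing e b
  cb≡eb = trans cb≡ad (trans (pairing≡ ad~be) (pairing-comm b e))
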